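{- On the space $\mathscr{A}_I\otimes \mathscr{S}_J$ one has $$Q_{\circ}\circ Q_{\square}+Q_{\square}\circ Q_{\circ}=L_+ ,\qquad L_+=\sum_{i=1}^N\frac{\partial}{\partial x_i}.$$
   Context: Let $N$ be a positive integer and $0\leq m\leq N$. Set $I=\{1,\ldots,m\}$, $J=\{m+1,\ldots,N\}$, $I_+=\{1,\ldots,m+1\}$, $I_-=\{1,\ldots,m-1\}$, $J_+=\{m,\ldots,N\}$, $J_-=\{m+2,\ldots,N\}$. Polynomials are in $x_1,\ldots,x_N$ with coefficients in $\mathbb{C}(\alpha)$; $K_{i,j}$ acts on functions by interchanging the variables $x_i$ and $x_j$. For a set $K$ of indices, $\mathscr{A}_K$ (resp. $\mathscr{S}_K$) denotes the polynomials antisymmetric (resp. symmetric) in the variables $x_k$, $k\in K$; so $\mathscr{A}_I\otimes \mathscr{S}_J$ consists of polynomials antisymmetric in $x_1,\ldots,x_m$ and symmetric in $x_{m+1},\ldots,x_N$. Define $Q_{\circ}:\mathscr{A}_I\otimes \mathscr{S}_J\to \mathscr{A}_{I_- }\otimes \mathscr{S}_{J_+}$, $f\mapsto \big(1+\sum_{i=m+1}^N K_{i,m}\big)f$ for $1\leq m\leq N$ (and $Q_{\circ}=0$ if $m=0$), and $Q_{\square}:\mathscr{A}_I\otimes \mathscr{S}_J\to \mathscr{A}_{I_+}\otimes \mathscr{S}_{J_- }$, $f\mapsto \big(1-\sum_{i=1}^m K_{i,m+1}\big)\frac{\partial f}{\partial x_{m+1}}$ for $0\leq m\leq N-1$ (and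 $Q_{\square}=0$ if $m=N$). -}

module Defs where

open import Level using (Level)
open import Algebra.Bundles using (CommutativeRing)
open import Data.Nat as ℕ using (ℕ; zero; suc; _∸_; _≤_; _≡ᵇ_)
open import Data.Fin using (Fin; toℕ)
open import Data.Vec using (Vec; []; _∷_; lookup; tabulate)
open import Data.Vec.Properties using (≡-dec)
open import Data.List as List using (List; []; _∷_; _++_; concat; upTo)
open import Data.Product using (_×_; _,_)
open import Data.Bool using (if_then_else_)
open import Relation.Nullary using (does)

-- Polynomials in variables x_1..x_N with coefficients in a commutative ring R,
-- represented as finite formal sums of terms (coefficient, exponent vector);
-- equality is coefficientwise equality (see _≈P_).
module WithRing {c ℓ : Level} (R : CommutativeRing c ℓ) where
  open CommutativeRing R

  Poly : ℕ → Set c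
  Poly N = List (Carrier × Vec ℕ N)

  coeff : ∀ {N} → Poly N → Vec ℕ N → Carrier
  coeff [] e = 0#
  coeff ((a , e') ∷ p) e = if does (≡-dec ℕ._≟_ e' e) then a + coeff p e else coeff p e

  infix 4 _≈P_
  _≈P_ : ∀ {N} → Poly N → Poly N → Set ℓ
  p ≈P q = ∀ e → coeff p e ≈ coeff q e

  zeroP : ∀ {N} → Poly N
  zeroP = []

  infixl 6 _+P_
  _+P_ : ∀ {N} → Poly N → Poly N → Poly N
  _+P_ = _++_

  negP : ∀ {N} → Poly N → Poly N
  negP = List.map (λ { (a , e) → (- a , e) })

  -- 1-based lookup, 0 outside range
  getN : ∀ {N} → Vec ℕ N → ℕ → ℕ
  getN [] _ = 0
  getN (x ∷ v) zero = 0
  getN (x ∷ v) (suc zero) = x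
  getN (x ∷ v) (suc (suc k)) = getN v (suc k)

  swapIdx : ℕ → ℕ → ℕ → ℕ
  swapIdx i j p = if p ≡ᵇ i then j else (if p ≡ᵇ j then i else p)

  K : ∀ {N} → ℕ → ℕ → Poly N → Poly N
  K i j = List.map (λ { (a , e) → (a , tabulate (λ k → getN e (swapIdx i j (suc (toℕ k))))) })

  natMul : ℕ → Carrier → Carrier
  natMul zero a = 0#
  natMul (suc n) a = a + natMul n a

  ∂ : ∀ {N} → ℕ → Poly N → Poly N
  ∂ i = List.map (λ { (a , e) →
          (natMul (getN e i) a ,
           tabulate (λ k → if suc (toℕ k) ≡ᵇ i then lookup e k ∸ 1 else lookup e k)) })

  range : ℕ → ℕ → List ℕ
  range a b = List.map (a ℕ.+_) (upTo (suc b ∸ a))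

  sumP : ∀ {N} → List ℕ → (ℕ → Poly N) → Poly N
  sumP is F = concat (List.map F is)

  Qcirc : (N m : ℕ) → Poly N → Poly N
  Qcirc N zero f = zeroP
  Qcirc N (suc k) f = f +P sumP (range (suc (suc k)) N) (λ i → K i (suc k) f)

  Qsq : (N m : ℕ) → Poly N → Poly N
  Qsq N m f = if m ≡ᵇ N then zeroP
              else (∂ (suc m) f +P negP (sumP (range 1 m) (λ i → K i (suc m) (∂ (suc m) f))))

  Lplus : (N : ℕ) → Poly N → Poly N
  Lplus N f = sumP (range 1 N) (λ i → ∂ i f)

  -- f ∈ 𝒜_I ⊗ 𝒮_J with I = {1..m}, J = {m+1..N}
  AntisymIn : ∀ {N} → ℕ → ℕ → Poly N → Set ℓ
  AntisymIn a b f = ∀ i j → a ≤ i → i ≤ b → a ≤ j → j ≤ b → i ≢ j → K i j f ≈P negP f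
    where open import Relation.Binary.PropositionalEquality using (_≢_)

  SymIn : ∀ {N} → ℕ → ℕ → Poly N → Set ℓ
  SymIn a b f = ∀ i j → a ≤ i → i ≤ b → a ≤ j → j ≤ b → K i j f ≈P f

  InAS : (N m : ℕ) → Poly N → Set ℓ
  InAS N m f = AntisymIn 1 m f × SymIn (suc m) N f

-- Both sides are compared coefficientwise.  Write g[w] for the coefficient of the monomial with
-- exponent vector w in g and fix an exponent e.  Since (K_{ab} g)[w] = g[σ_{ab} w] and
-- (∂_i g)[e] = (e_i + 1) g[e + 1_i], every term of Q∘Q□f + Q□Q∘f at e is ± (e_i + 1) f[w], where w
-- is obtained from e + 1_i by at most three transpositions.  By the symmetry of f in x_{m+1}, …, x_N
-- the derivative terms of Q∘Q□f make up Σ_{i>m} ∂_i f, and by the antisymmetry in x_1, …, x_m those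
-- of Q□Q∘f make up Σ_{i≤m} ∂_i f.  The remaining terms ("defects") of the two products agree term by
-- term, by (anti)symmetry of f combined with the relations (i m+1) = (i m)(m+1 m)(i m) and
-- (i m+1)(j m+1) = (m+1 j)(i j) between transpositions, so they cancel.  For m = 0 and m = N one
-- product vanishes together with the defect of the other.

module Submission where

open import Defs
open import Level using (Level)
open import Algebra.Bundles using (CommutativeRing)
open import Data.Nat as ℕ using (ℕ; zero; suc; _≤_; _<_; _∸_; _≡ᵇ_; _≟_; z≤n; s≤s; z<s)
open import Data.Nat.Properties as ℕₚ
  using (≤-refl; ≤-trans; ≤-pred; <⇒≤; <⇒≢; m<m+n; m+[n∸m]≡n; +-∸-assoc; n∸n≡0; m≤n⇒m<n∨m≡n)
open import Data.Fin using (Fin; toℕ; fromℕ<)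
open import Data.Fin.Properties using (toℕ<n; toℕ-fromℕ<)
open import Data.Vec using (Vec; []; _∷_; lookup; tabulate)
open import Data.Vec.Properties using (≡-dec; lookup∘tabulate; tabulate∘lookup; tabulate-cong)
open import Data.List as List using ([]; _∷_; applyUpTo)
open import Data.Product using (Σ; _×_; _,_)
open import Data.Sum using (inj₁; inj₂)
open import Data.Bool using (true; false; if_then_else_)
open import Data.Empty using (⊥-elim)
open import Function using (id; _∘_)
open import Relation.Nullary using (yes; no; does)
open import Relation.Nullary.Decidable using (dec-true; dec-false)
open import Relation.Binary.PropositionalEquality as ≡ using (_≡_; _≢_; refl; cong; cong₂; subst; ≢-sym)

module _ {c ℓ : Level} (R : CommutativeRing c ℓ) where
  open WithRing R

  -- Transpositions of variables and exponent vectors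

  InRange : ℕ → ℕ → Set
  InRange N p = 1 ≤ p × p ≤ N

  private
    ≡ᵇ-true : ∀ {m n} → m ≡ n → (m ≡ᵇ n) ≡ true
    ≡ᵇ-true {m} {n} = dec-true (m ≟ n)

    ≡ᵇ-false : ∀ {m n} → m ≢ n → (m ≡ᵇ n) ≡ false
    ≡ᵇ-false {m} {n} = dec-false (m ≟ n)

  swapIdx-left : ∀ i j → swapIdx i j i ≡ j
  swapIdx-left i j rewrite ≡ᵇ-true {i} refl = refl

  swapIdx-right : ∀ i j → swapIdx i j j ≡ i
  swapIdx-right i j with j ≟ i
  ... | yes refl = swapIdx-left j j
  ... | no j≢i rewrite ≡ᵇ-false j≢i | ≡ᵇ-true {j} refl = refl

  swapIdx-other : ∀ {i j p} → p ≢ i → p ≢ j → swapIdx i j p ≡ p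
  swapIdx-other p≢i p≢j rewrite ≡ᵇ-false p≢i | ≡ᵇ-false p≢j = refl

  swapIdx-comm : ∀ i j p → swapIdx i j p ≡ swapIdx j i p
  swapIdx-comm i j p with p ≟ i | p ≟ j
  ... | yes refl | _ = ≡.trans (swapIdx-left p j) (≡.sym (swapIdx-right j p))
  ... | no _ | yes refl = ≡.trans (swapIdx-right i p) (≡.sym (swapIdx-left p i))
  ... | no p≢i | no p≢j = ≡.trans (swapIdx-other p≢i p≢j) (≡.sym (swapIdx-other p≢j p≢i))

  swapIdx-involutive : ∀ i j p → swapIdx i j (swapIdx i j p) ≡ p
  swapIdx-involutive i j p with p ≟ i | p ≟ j
  ... | yes refl | _ rewrite swapIdx-left p j = swapIdx-right p j
  ... | no _ | yes refl rewrite swapIdx-right i p = swapIdx-left i p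
  ... | no p≢i | no p≢j rewrite swapIdx-other p≢i p≢j = swapIdx-other p≢i p≢j

  swapIdx-injective : ∀ i j {p q} → swapIdx i j p ≡ swapIdx i j q → p ≡ q
  swapIdx-injective i j {p} {q} eq =
    ≡.trans (≡.sym (swapIdx-involutive i j p)) (≡.trans (cong (swapIdx i j) eq) (swapIdx-involutive i j q))

  swapIdx-conj : ∀ {a b c} → a ≢ b → a ≢ c → b ≢ c → ∀ p →
                 swapIdx a c (swapIdx b c (swapIdx a c p)) ≡ swapIdx a b p
  swapIdx-conj {a} {b} {c} a≢b a≢c b≢c p with p ≟ a | p ≟ b | p ≟ c
  ... | yes refl | _ | _
    rewrite swapIdx-left p c | swapIdx-right b c | swapIdx-other (≢-sym a≢b) b≢c | swapIdx-left p b = refl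
  ... | no p≢a | yes refl | _
    rewrite swapIdx-other p≢a b≢c | swapIdx-left p c | swapIdx-right a c | swapIdx-right a p = refl
  ... | no p≢a | no p≢b | yes refl
    rewrite swapIdx-right a p | swapIdx-other a≢b a≢c | swapIdx-left a p | swapIdx-other p≢a p≢b = refl
  ... | no p≢a | no p≢b | no p≢c
    rewrite swapIdx-other p≢a p≢c | swapIdx-other p≢b p≢c | swapIdx-other p≢a p≢c | swapIdx-other p≢a p≢b = refl

  swapIdx-inRange : ∀ {N i j p} → InRange N i → InRange N j → InRange N p → InRange N (swapIdx i j p)
  swapIdx-inRange {i = i} {j} {p} ri rj rp with p ≟ i | p ≟ j
  ... | yes refl | _ = subst (InRange _) (≡.sym (swapIdx-left p j)) rj
  ... | no _ | yes refl = subst (InRange _) (≡.sym (swapIdx-right i p)) ri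
  ... | no p≢i | no p≢j = subst (InRange _) (≡.sym (swapIdx-other p≢i p≢j)) rp

  toℕ-inRange : ∀ {N} (k : Fin N) → InRange N (suc (toℕ k))
  toℕ-inRange {suc N} k = s≤s z≤n , toℕ<n k

  inRange⇒Fin : ∀ {N p} → InRange N p → Σ (Fin N) (λ k → suc (toℕ k) ≡ p)
  inRange⇒Fin {N} {suc p} (_ , p<N) = fromℕ< p<N , cong suc (toℕ-fromℕ< p<N)

  getN-lookup : ∀ {N} (v : Vec ℕ N) k → getN v (suc (toℕ k)) ≡ lookup v k
  getN-lookup (x ∷ v) Fin.zero = refl
  getN-lookup (x ∷ v) (Fin.suc k) = getN-lookup v k

  getN-tabulate : ∀ {N} (h : Fin N → ℕ) k → getN (tabulate h) (suc (toℕ k)) ≡ h k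
  getN-tabulate h k = ≡.trans (getN-lookup (tabulate h) k) (lookup∘tabulate h k)

  getN-ext : ∀ {N} {u v : Vec ℕ N} → (∀ {p} → InRange N p → getN u p ≡ getN v p) → u ≡ v
  getN-ext {u = u} {v} u≗v =
    ≡.trans (≡.sym (tabulate∘lookup u)) (≡.trans (tabulate-cong pointwise) (tabulate∘lookup v))
    where
    pointwise : ∀ k → lookup u k ≡ lookup v k
    pointwise k = ≡.trans (≡.sym (getN-lookup u k)) (≡.trans (u≗v (toℕ-inRange k)) (getN-lookup v k))

  reindex : ∀ {N} → (ℕ → ℕ) → Vec ℕ N → Vec ℕ N
  reindex π v = tabulate (λ k → getN v (π (suc (toℕ k))))

  getN-reindex : ∀ {N} π (v : Vec ℕ N) {p} → InRange N p → getN (reindex π v) p ≡ getN v (π p)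
  getN-reindex π v r with inRange⇒Fin r
  ... | k , refl = getN-tabulate _ k

  reindex-∘ : ∀ {N} {π} ρ (v : Vec ℕ N) → (∀ {p} → InRange N p → InRange N (π p)) →
              reindex π (reindex ρ v) ≡ reindex (ρ ∘ π) v
  reindex-∘ ρ v π-inRange = tabulate-cong (λ k → getN-reindex ρ v (π-inRange (toℕ-inRange k)))

  reindex-cong : ∀ {N π ρ} (v : Vec ℕ N) → (∀ p → π p ≡ ρ p) → reindex π v ≡ reindex ρ v
  reindex-cong v π≗ρ = tabulate-cong (λ k → cong (getN v) (π≗ρ _))

  reindex-id : ∀ {N} (v : Vec ℕ N) → reindex id v ≡ v
  reindex-id v = getN-ext (getN-reindex id v)

  swapExp : ∀ {N} → ℕ → ℕ → Vec ℕ N → Vec ℕ N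
  swapExp i j = reindex (swapIdx i j)

  swapExp-comm : ∀ {N} i j (v : Vec ℕ N) → swapExp i j v ≡ swapExp j i v
  swapExp-comm i j v = reindex-cong v (swapIdx-comm i j)

  swapExp-involutive : ∀ {N i j} → InRange N i → InRange N j → (v : Vec ℕ N) → swapExp i j (swapExp i j v) ≡ v
  swapExp-involutive {i = i} {j} ri rj v = begin
    swapExp i j (swapExp i j v)               ≡⟨ reindex-∘ (swapIdx i j) v (swapIdx-inRange ri rj) ⟩
    reindex (swapIdx i j ∘ swapIdx i j) v     ≡⟨ reindex-cong v (swapIdx-involutive i j) ⟩
    reindex id v                              ≡⟨ reindex-id v ⟩
    v                                         ∎
    where open ≡.≡-Reasoning

  swapExp-conj : ∀ {N a b c} → InRange N a → InRange N b → InRange N c → a ≢ b → a ≢ c → b ≢ c →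
                 (v : Vec ℕ N) → swapExp a c (swapExp b c (swapExp a c v)) ≡ swapExp a b v
  swapExp-conj {a = a} {b} {c} ra rb rc a≢b a≢c b≢c v = begin
    swapExp a c (swapExp b c (swapExp a c v))
      ≡⟨ cong (swapExp a c) (reindex-∘ (swapIdx a c) v (swapIdx-inRange rb rc)) ⟩
    swapExp a c (reindex (swapIdx a c ∘ swapIdx b c) v)
      ≡⟨ reindex-∘ (swapIdx a c ∘ swapIdx b c) v (swapIdx-inRange ra rc) ⟩
    reindex (swapIdx a c ∘ swapIdx b c ∘ swapIdx a c) v
      ≡⟨ reindex-cong v (swapIdx-conj a≢b a≢c b≢c) ⟩
    swapExp a b v ∎
    where open ≡.≡-Reasoning

  swapExp-braid : ∀ {N a b c} → InRange N a → InRange N b → InRange N c → a ≢ b → a ≢ c → b ≢ c →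
                  (v : Vec ℕ N) → swapExp a c (swapExp b c v) ≡ swapExp a b (swapExp a c v)
  swapExp-braid {a = a} {b} {c} ra rb rc a≢b a≢c b≢c v = begin
    swapExp a c (swapExp b c v)
      ≡⟨ cong (swapExp a c ∘ swapExp b c) (≡.sym (swapExp-involutive ra rc v)) ⟩
    swapExp a c (swapExp b c (swapExp a c (swapExp a c v)))
      ≡⟨ swapExp-conj ra rb rc a≢b a≢c b≢c (swapExp a c v) ⟩
    swapExp a b (swapExp a c v) ∎
    where open ≡.≡-Reasoning

  update : ∀ {N} → ℕ → (ℕ → ℕ) → Vec ℕ N → Vec ℕ N
  update i g e = tabulate (λ k → if suc (toℕ k) ≡ᵇ i then g (lookup e k) else lookup e k)

  getN-update-same : ∀ {N i} g (e : Vec ℕ N) → InRange N i → getN (update i g e) i ≡ g (getN e i)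
  getN-update-same g e r with inRange⇒Fin r
  ... | k , refl rewrite getN-tabulate (λ q → if suc (toℕ q) ≡ᵇ suc (toℕ k) then g (lookup e q) else lookup e q) k
                       | ≡ᵇ-true {suc (toℕ k)} refl | getN-lookup e k = refl

  getN-update-other : ∀ {N i p} g (e : Vec ℕ N) → InRange N p → p ≢ i → getN (update i g e) p ≡ getN e p
  getN-update-other {i = i} g e r p≢i with inRange⇒Fin r
  ... | k , refl rewrite getN-tabulate (λ q → if suc (toℕ q) ≡ᵇ i then g (lookup e q) else lookup e q) k
                       | ≡ᵇ-false p≢i | getN-lookup e k = refl

  incExp decExp : ∀ {N} → ℕ → Vec ℕ N → Vec ℕ N
  incExp i = update i suc
  decExp i = update i (λ n → n ∸ 1)

  decExp-incExp : ∀ {N} i (e : Vec ℕ N) → decExp i (incExp i e) ≡ e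
  decExp-incExp i e = getN-ext pointwise
    where
    pointwise : ∀ {p} → InRange _ p → getN (decExp i (incExp i e)) p ≡ getN e p
    pointwise {p} r with p ≟ i
    ... | yes refl rewrite getN-update-same (λ n → n ∸ 1) (incExp p e) r | getN-update-same suc e r = refl
    ... | no p≢i rewrite getN-update-other (λ n → n ∸ 1) (incExp i e) r p≢i
                       | getN-update-other suc e r p≢i = refl

  incExp-decExp : ∀ {N} i (e : Vec ℕ N) → getN e i ≢ 0 → incExp i (decExp i e) ≡ e
  incExp-decExp i e eᵢ≢0 = getN-ext pointwise
    where
    pointwise : ∀ {p} → InRange _ p → getN (incExp i (decExp i e)) p ≡ getN e p
    pointwise {p} r with p ≟ i
    ... | no p≢i rewrite getN-update-other suc (decExp i e) r p≢i
                       | getN-update-other (λ n → n ∸ 1) e r p≢i = refl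
    ... | yes refl rewrite getN-update-same suc (decExp p e) r | getN-update-same (λ n → n ∸ 1) e r
      with getN e p
    ...   | zero = ⊥-elim (eᵢ≢0 refl)
    ...   | suc n = refl

  incExp-swapExp : ∀ {N a b} c (e : Vec ℕ N) → InRange N a → InRange N b →
                   incExp c (swapExp a b e) ≡ swapExp a b (incExp (swapIdx a b c) e)
  incExp-swapExp {a = a} {b} c e ra rb = getN-ext pointwise
    where
    pointwise : ∀ {p} → InRange _ p → getN (incExp c (swapExp a b e)) p ≡ getN (swapExp a b (incExp (swapIdx a b c) e)) p
    pointwise {p} r rewrite getN-reindex (swapIdx a b) (incExp (swapIdx a b c) e) r with p ≟ c
    ... | yes refl rewrite getN-update-same suc (swapExp a b e) r | getN-reindex (swapIdx a b) e r
                         | getN-update-same suc e (swapIdx-inRange ra rb r) = refl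
    ... | no p≢c rewrite getN-update-other suc (swapExp a b e) r p≢c | getN-reindex (swapIdx a b) e r
                       | getN-update-other suc e (swapIdx-inRange ra rb r) (p≢c ∘ swapIdx-injective a b) = refl

  -- Coefficients of K, ∂, Q∘, Q□ and L₊

  module _ where
    open CommutativeRing R renaming (refl to ≈-refl)
    open import Relation.Binary.Reasoning.Setoid setoid
    open import Algebra.Properties.AbelianGroup +-abelianGroup using (ε⁻¹≈ε; ⁻¹-∙-comm; ⁻¹-involutive)
    open import Algebra.Properties.CommutativeSemigroup +-commutativeSemigroup using (interchange)

    -‿+ : ∀ x y → - (x + y) ≈ - x + - y
    -‿+ x y = sym (⁻¹-∙-comm x y)

    natMul-cong : ∀ n {a b} → a ≈ b → natMul n a ≈ natMul n b
    natMul-cong zero a≈b = ≈-refl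
    natMul-cong (suc n) a≈b = +-cong a≈b (natMul-cong n a≈b)

    natMul-+ : ∀ n a b → natMul n (a + b) ≈ natMul n a + natMul n b
    natMul-+ zero a b = sym (+-identityˡ 0#)
    natMul-+ (suc n) a b = trans (+-congˡ (natMul-+ n a b)) (interchange a b _ _)

    natMul-0# : ∀ n → natMul n 0# ≈ 0#
    natMul-0# zero = ≈-refl
    natMul-0# (suc n) = trans (+-identityˡ _) (natMul-0# n)

    natMul-neg : ∀ n a → natMul n (- a) ≈ - natMul n a
    natMul-neg zero a = sym ε⁻¹≈ε
    natMul-neg (suc n) a = trans (+-congˡ (natMul-neg n a)) (sym (-‿+ a _))

    sumFrom : ℕ → ℕ → (ℕ → Carrier) → Carrier
    sumFrom a zero F = 0#
    sumFrom a (suc n) F = F a + sumFrom (suc a) n F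

    sumFrom-cong : ∀ a n {F G : ℕ → Carrier} → (∀ {i} → a ≤ i → i < a ℕ.+ n → F i ≈ G i) →
                   sumFrom a n F ≈ sumFrom a n G
    sumFrom-cong a zero F≈G = ≈-refl
    sumFrom-cong a (suc n) {F} {G} F≈G = +-cong (F≈G ≤-refl (m<m+n a z<s))
      (sumFrom-cong (suc a) n λ {i} a<i i<a+1+n →
        F≈G (<⇒≤ a<i) (subst (i <_) (≡.sym (ℕₚ.+-suc a n)) i<a+1+n))

    sumFrom-cong′ : ∀ a n {F G : ℕ → Carrier} → (∀ i → F i ≈ G i) → sumFrom a n F ≈ sumFrom a n G
    sumFrom-cong′ a n F≈G = sumFrom-cong a n (λ {i} _ _ → F≈G i)

    sumFrom-+ : ∀ a n (F G : ℕ → Carrier) → sumFrom a n (λ i → F i + G i) ≈ sumFrom a n F + sumFrom a n G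
    sumFrom-+ a zero F G = sym (+-identityˡ 0#)
    sumFrom-+ a (suc n) F G = trans (+-congˡ (sumFrom-+ (suc a) n F G)) (interchange (F a) (G a) _ _)

    sumFrom-neg : ∀ a n (F : ℕ → Carrier) → sumFrom a n (λ i → - F i) ≈ - sumFrom a n F
    sumFrom-neg a zero F = sym ε⁻¹≈ε
    sumFrom-neg a (suc n) F = trans (+-congˡ (sumFrom-neg (suc a) n F)) (sym (-‿+ _ _))

    sumFrom-natMul : ∀ k a n (F : ℕ → Carrier) → natMul k (sumFrom a n F) ≈ sumFrom a n (λ i → natMul k (F i))
    sumFrom-natMul k a zero F = natMul-0# k
    sumFrom-natMul k a (suc n) F = trans (natMul-+ k _ _) (+-congˡ (sumFrom-natMul k (suc a) n F))

    sumFrom-0# : ∀ a n → sumFrom a n (λ _ → 0#) ≈ 0#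
    sumFrom-0# a zero = ≈-refl
    sumFrom-0# a (suc n) = trans (+-identityˡ _) (sumFrom-0# (suc a) n)

    sumFrom-split : ∀ a p q (F : ℕ → Carrier) → sumFrom a (p ℕ.+ q) F ≈ sumFrom a p F + sumFrom (a ℕ.+ p) q F
    sumFrom-split a zero q F =
      trans (reflexive (cong (λ b → sumFrom b q F) (≡.sym (ℕₚ.+-identityʳ a)))) (sym (+-identityˡ _))
    sumFrom-split a (suc p) q F = begin
      F a + sumFrom (suc a) (p ℕ.+ q) F                         ≈⟨ +-congˡ (sumFrom-split (suc a) p q F) ⟩
      F a + (sumFrom (suc a) p F + sumFrom (suc a ℕ.+ p) q F)   ≈⟨ sym (+-assoc _ _ _) ⟩
      sumFrom a (suc p) F + sumFrom (suc a ℕ.+ p) q F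
        ≡⟨ cong (λ b → sumFrom a (suc p) F + sumFrom b q F) (≡.sym (ℕₚ.+-suc a p)) ⟩
      sumFrom a (suc p) F + sumFrom (a ℕ.+ suc p) q F           ∎

    sumFrom-snoc : ∀ a n (F : ℕ → Carrier) → sumFrom a (suc n) F ≈ sumFrom a n F + F (a ℕ.+ n)
    sumFrom-snoc a n F = begin
      sumFrom a (suc n) F                              ≡⟨ cong (λ m → sumFrom a m F) (ℕₚ.+-comm 1 n) ⟩
      sumFrom a (n ℕ.+ 1) F                            ≈⟨ sumFrom-split a n 1 F ⟩
      sumFrom a n F + (F (a ℕ.+ n) + 0#)               ≈⟨ +-congˡ (+-identityʳ _) ⟩
      sumFrom a n F + F (a ℕ.+ n)                      ∎

    sumFrom-comm : ∀ a n b p (G : ℕ → ℕ → Carrier) →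
                   sumFrom a n (λ j → sumFrom b p (G j)) ≈ sumFrom b p (λ i → sumFrom a n (λ j → G j i))
    sumFrom-comm a zero b p G = sym (sumFrom-0# b p)
    sumFrom-comm a (suc n) b p G = trans (+-congˡ (sumFrom-comm (suc a) n b p G)) (sym (sumFrom-+ b p (G a) _))

    sumFrom-1-split : ∀ {m N} (F : ℕ → Carrier) → m < N →
                      sumFrom 1 N F ≈ sumFrom 1 m F + (F (suc m) + sumFrom (suc (suc m)) (N ∸ suc m) F)
    sumFrom-1-split {m} {N} F m<N = begin
      sumFrom 1 N F                                 ≡⟨ cong (λ n → sumFrom 1 n F) (≡.sym (m+[n∸m]≡n (<⇒≤ m<N))) ⟩
      sumFrom 1 (m ℕ.+ (N ∸ m)) F                   ≈⟨ sumFrom-split 1 m (N ∸ m) F ⟩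
      sumFrom 1 m F + sumFrom (suc m) (N ∸ m) F     ≡⟨ cong (λ n → sumFrom 1 m F + sumFrom (suc m) n F) (+-∸-assoc 1 m<N) ⟩
      sumFrom 1 m F + (F (suc m) + sumFrom (suc (suc m)) (N ∸ suc m) F) ∎

    coeff-+P : ∀ {N} (p q : Poly N) e → coeff (p +P q) e ≈ coeff p e + coeff q e
    coeff-+P [] q e = sym (+-identityˡ _)
    coeff-+P ((a , e') ∷ p) q e with does (≡-dec _≟_ e' e)
    ... | true = trans (+-congˡ (coeff-+P p q e)) (sym (+-assoc _ _ _))
    ... | false = coeff-+P p q e

    coeff-negP : ∀ {N} (p : Poly N) e → coeff (negP p) e ≈ - coeff p e
    coeff-negP [] e = sym ε⁻¹≈ε
    coeff-negP ((a , e') ∷ p) e with does (≡-dec _≟_ e' e)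
    ... | true = trans (+-congˡ (coeff-negP p e)) (sym (-‿+ _ _))
    ... | false = coeff-negP p e

    coeff-sumP-shift : ∀ {N} n {a} b (g : ℕ → ℕ) → (∀ k → a ℕ.+ g k ≡ b ℕ.+ k) →
                       (F : ℕ → Poly N) (e : Vec ℕ N) →
                       coeff (sumP (List.map (a ℕ.+_) (applyUpTo g n)) F) e ≈ sumFrom b n (λ i → coeff (F i) e)
    coeff-sumP-shift zero b g shift F e = ≈-refl
    coeff-sumP-shift (suc n) {a} b g shift F e = trans (coeff-+P (F (a ℕ.+ g 0)) _ e)
      (+-cong (reflexive (cong (λ i → coeff (F i) e) (≡.trans (shift 0) (ℕₚ.+-identityʳ b))))
              (coeff-sumP-shift n (suc b) (g ∘ suc) (λ k → ≡.trans (shift (suc k)) (ℕₚ.+-suc b k)) F e))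

    coeff-sumP-range : ∀ {N} a b (F : ℕ → Poly N) (e : Vec ℕ N) →
                       coeff (sumP (range a b) F) e ≈ sumFrom a (suc b ∸ a) (λ i → coeff (F i) e)
    coeff-sumP-range a b = coeff-sumP-shift (suc b ∸ a) a id (λ _ → refl)

    coeff-K : ∀ {N i j} → InRange N i → InRange N j → (p : Poly N) (e : Vec ℕ N) →
              coeff (K i j p) e ≈ coeff p (swapExp i j e)
    coeff-K ri rj [] e = ≈-refl
    coeff-K {i = i} {j} ri rj ((a , e') ∷ p) e with ≡-dec _≟_ (swapExp i j e') e | ≡-dec _≟_ e' (swapExp i j e)
    ... | yes _ | yes _ = +-congˡ (coeff-K ri rj p e)
    ... | no _ | no _ = coeff-K ri rj p e
    ... | yes σe'≡e | no e'≢σe =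
      ⊥-elim (e'≢σe (≡.trans (≡.sym (swapExp-involutive ri rj e')) (cong (swapExp i j) σe'≡e)))
    ... | no σe'≢e | yes e'≡σe = ⊥-elim (σe'≢e (≡.trans (cong (swapExp i j) e'≡σe) (swapExp-involutive ri rj e)))

    -- decExp i, the exponent map of ∂ i, truncates at 0, so two monomials may land on the same
    -- exponent; the one with exponent 0 in x_i carries the factor natMul 0 and contributes 0.
    coeff-∂ : ∀ {N i} → InRange N i → (p : Poly N) (e : Vec ℕ N) →
              coeff (∂ i p) e ≈ natMul (suc (getN e i)) (coeff p (incExp i e))
    coeff-∂ {i = i} r [] e = sym (natMul-0# (suc (getN e i)))
    coeff-∂ {i = i} r ((a , e') ∷ p) e with ≡-dec _≟_ (decExp i e') e | ≡-dec _≟_ e' (incExp i e)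
    ... | yes _ | yes refl = begin
      natMul (getN (incExp i e) i) a + coeff (∂ i p) e
        ≈⟨ +-cong (reflexive (cong (λ n → natMul n a) (getN-update-same suc e r))) (coeff-∂ r p e) ⟩
      natMul (suc (getN e i)) a + natMul (suc (getN e i)) (coeff p (incExp i e))
        ≈⟨ sym (natMul-+ (suc (getN e i)) a _) ⟩
      natMul (suc (getN e i)) (a + coeff p (incExp i e)) ∎
    ... | no de'≢e | yes refl = ⊥-elim (de'≢e (decExp-incExp i e))
    ... | no _ | no _ = coeff-∂ r p e
    ... | yes de'≡e | no e'≢ie with getN e' i ≟ 0
    ...   | no e'ᵢ≢0 = ⊥-elim (e'≢ie (≡.trans (≡.sym (incExp-decExp i e' e'ᵢ≢0)) (cong (incExp i) de'≡e)))
    ...   | yes e'ᵢ≡0 =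
      trans (+-congʳ (reflexive (cong (λ n → natMul n a) e'ᵢ≡0))) (trans (+-identityˡ _) (coeff-∂ r p e))

    coeff-∂-swapExp : ∀ {N a b c c'} → InRange N a → InRange N b → InRange N c → swapIdx a b c ≡ c' →
                      (p : Poly N) (x : Vec ℕ N) →
                      coeff (∂ c p) (swapExp a b x) ≈ natMul (suc (getN x c')) (coeff p (swapExp a b (incExp c' x)))
    coeff-∂-swapExp {a = a} {b} {c} ra rb rc refl p x = begin
      coeff (∂ c p) (swapExp a b x)                                    ≈⟨ coeff-∂ rc p (swapExp a b x) ⟩
      natMul (suc (getN (swapExp a b x) c)) (coeff p (incExp c (swapExp a b x)))
        ≡⟨ cong₂ (λ n y → natMul (suc n) (coeff p y)) (getN-reindex (swapIdx a b) x rc) (incExp-swapExp c x ra rb) ⟩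
      natMul (suc (getN x (swapIdx a b c))) (coeff p (swapExp a b (incExp (swapIdx a b c) x))) ∎

    private
      ≤-from-sumFrom-bound : ∀ {m N i} → m ≤ N → i < suc m ℕ.+ (N ∸ m) → i ≤ N
      ≤-from-sumFrom-bound {i = i} m≤N i<bound = ≤-pred (subst (i <_) (cong suc (m+[n∸m]≡n m≤N)) i<bound)

    Qsq-unfold : ∀ {N m} → m ≢ N → (p : Poly N) →
                 Qsq N m p ≡ ∂ (suc m) p +P negP (sumP (range 1 m) (λ i → K i (suc m) (∂ (suc m) p)))
    Qsq-unfold m≢N p rewrite ≡ᵇ-false m≢N = refl

    Qsq-top : ∀ {N m} → m ≡ N → (p : Poly N) → Qsq N m p ≡ zeroP
    Qsq-top m≡N p rewrite ≡ᵇ-true m≡N = refl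

    coeff-Qsq : ∀ {N m} → m < N → (p : Poly N) (x : Vec ℕ N) →
                coeff (Qsq N m p) x ≈
                coeff (∂ (suc m) p) x + - sumFrom 1 m (λ i → coeff (∂ (suc m) p) (swapExp i (suc m) x))
    coeff-Qsq {N} {m} m<N p x = begin
      coeff (Qsq N m p) x                                             ≡⟨ cong (λ q → coeff q x) (Qsq-unfold (<⇒≢ m<N) p) ⟩
      coeff (∂ (suc m) p +P negP (sumP (range 1 m) Kᵢ∂)) x             ≈⟨ coeff-+P (∂ (suc m) p) _ x ⟩
      coeff (∂ (suc m) p) x + coeff (negP (sumP (range 1 m) Kᵢ∂)) x   ≈⟨ +-congˡ (coeff-negP (sumP (range 1 m) Kᵢ∂) x) ⟩
      coeff (∂ (suc m) p) x + - coeff (sumP (range 1 m) Kᵢ∂) x        ≈⟨ +-congˡ (-‿cong (coeff-sumP-range 1 m Kᵢ∂ x)) ⟩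
      coeff (∂ (suc m) p) x + - sumFrom 1 m (λ i → coeff (Kᵢ∂ i) x)
        ≈⟨ +-congˡ (-‿cong (sumFrom-cong 1 m λ 1≤i i≤m →
             coeff-K (1≤i , ≤-trans (≤-pred i≤m) (<⇒≤ m<N)) (s≤s z≤n , m<N) (∂ (suc m) p) x)) ⟩
      coeff (∂ (suc m) p) x + - sumFrom 1 m (λ i → coeff (∂ (suc m) p) (swapExp i (suc m) x)) ∎
      where
      Kᵢ∂ : ℕ → Poly N
      Kᵢ∂ i = K i (suc m) (∂ (suc m) p)

    coeff-Qcirc : ∀ {N k} → suc k ≤ N → (p : Poly N) (x : Vec ℕ N) →
                  coeff (Qcirc N (suc k) p) x ≈
                  coeff p x + sumFrom (suc (suc k)) (N ∸ suc k) (λ j → coeff p (swapExp j (suc k) x))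
    coeff-Qcirc {N} {k} k<N p x = trans (coeff-+P p _ x) (+-congˡ (trans
      (coeff-sumP-range (suc (suc k)) N (λ j → K j (suc k) p) x)
      (sumFrom-cong (suc (suc k)) (N ∸ suc k) λ k+1<j j<bound →
        coeff-K (≤-trans (s≤s z≤n) k+1<j , ≤-from-sumFrom-bound k<N j<bound) (s≤s z≤n , k<N) p x)))

    coeff-Lplus : ∀ {N} (p : Poly N) (x : Vec ℕ N) →
                  coeff (Lplus N p) x ≈ sumFrom 1 N (λ i → natMul (suc (getN x i)) (coeff p (incExp i x)))
    coeff-Lplus {N} p x = trans (coeff-sumP-range 1 N _ x)
      (sumFrom-cong 1 N λ 1≤i i<1+N → coeff-∂ (1≤i , ≤-pred i<1+N) p x)

    -‿interchange : ∀ x y u v → (x + - u) + (y + - v) ≈ (x + y) + - (u + v)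
    -‿interchange x y u v = trans (interchange x (- u) y (- v)) (+-congˡ (sym (-‿+ u v)))

    -‿cancel : ∀ x y d → (x + - d) + (y + d) ≈ x + y
    -‿cancel x y d = begin
      (x + - d) + (y + d)   ≈⟨ interchange x (- d) y d ⟩
      (x + y) + (- d + d)   ≈⟨ +-congˡ (-‿inverseˡ d) ⟩
      (x + y) + 0#          ≈⟨ +-identityʳ _ ⟩
      x + y                 ∎

    module _ {N : ℕ} (f : Poly N) where

      AntisymmetricCoeffs : ℕ → Set ℓ
      AntisymmetricCoeffs m = ∀ {i j} → InRange m i → InRange m j → i ≢ j →
                              ∀ x → coeff f (swapExp i j x) ≈ - coeff f x

      SymmetricCoeffs : ℕ → Set ℓ
      SymmetricCoeffs m = ∀ {i j} → suc m ≤ i → i ≤ N → suc m ≤ j → j ≤ N →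
                          ∀ x → coeff f (swapExp i j x) ≈ coeff f x

      antisymIn⇒coeffs : ∀ {m} → m ≤ N → AntisymIn 1 m f → AntisymmetricCoeffs m
      antisymIn⇒coeffs m≤N anti {i} {j} (1≤i , i≤m) (1≤j , j≤m) i≢j x = begin
        coeff f (swapExp i j x) ≈⟨ sym (coeff-K (1≤i , ≤-trans i≤m m≤N) (1≤j , ≤-trans j≤m m≤N) f x) ⟩
        coeff (K i j f) x       ≈⟨ anti i j 1≤i i≤m 1≤j j≤m i≢j x ⟩
        coeff (negP f) x        ≈⟨ coeff-negP f x ⟩
        - coeff f x             ∎

      symIn⇒coeffs : ∀ {m} → SymIn (suc m) N f → SymmetricCoeffs m
      symIn⇒coeffs sym′ {i} {j} m<i i≤N m<j j≤N x = begin
        coeff f (swapExp i j x) ≈⟨ sym (coeff-K (≤-trans (s≤s z≤n) m<i , i≤N) (≤-trans (s≤s z≤n) m<j , j≤N) f x) ⟩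
        coeff (K i j f) x       ≈⟨ sym′ i j m<i i≤N m<j j≤N x ⟩
        coeff f x               ∎

    -- The anticommutator, coefficientwise

    module Anticommutator {N : ℕ} (f : Poly N) (e : Vec ℕ N) where

      -- coeff (∂ i f) e ≈ D i (e⁺ i) by coeff-∂; every term of both products at e is ± D i w.
      D : ℕ → Vec ℕ N → Carrier
      D i x = natMul (suc (getN e i)) (coeff f x)

      e⁺ : ℕ → Vec ℕ N
      e⁺ i = incExp i e

      coeff-∂-at-swap² : ∀ {a b a' b' c c'} → InRange N a → InRange N b → InRange N a' → InRange N b' → InRange N c →
                         swapIdx a b c ≡ c' → swapIdx a' b' c' ≡ c' →
                         coeff (∂ c f) (swapExp a b (swapExp a' b' e)) ≈ D c' (swapExp a b (swapExp a' b' (e⁺ c')))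
      coeff-∂-at-swap² {a} {b} {a'} {b'} {c} {c'} ra rb ra' rb' rc refl σ'c'≡c' = begin
        coeff (∂ c f) (swapExp a b (swapExp a' b' e))
          ≈⟨ coeff-∂-swapExp ra rb rc refl f (swapExp a' b' e) ⟩
        natMul (suc (getN (swapExp a' b' e) c')) (coeff f (swapExp a b (incExp c' (swapExp a' b' e))))
          ≡⟨ cong₂ (λ n y → natMul (suc n) (coeff f (swapExp a b y)))
                   (≡.trans (getN-reindex (swapIdx a' b') e rc') (cong (getN e) σ'c'≡c'))
                   (≡.trans (incExp-swapExp c' e ra' rb') (cong (λ i → swapExp a' b' (incExp i e)) σ'c'≡c')) ⟩
        D c' (swapExp a b (swapExp a' b' (e⁺ c'))) ∎
        where
        rc' : InRange N c'
        rc' = swapIdx-inRange ra rb rc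

      -- The terms of Q∘Q□ f (at level m) and of Q□Q∘ f (at level k + 1) that are not derivatives of f.
      defectA : ℕ → Carrier
      defectA m = sumFrom 1 m (λ i → D i (swapExp i (suc m) (e⁺ i)))
                + sumFrom (suc (suc m)) (N ∸ suc m) (λ j →
                    sumFrom 1 m (λ i → D i (swapExp i (suc m) (swapExp j (suc m) (e⁺ i)))))

      coeff-Qcirc∘Qsq : ∀ {m} → m < N → SymmetricCoeffs f m →
        coeff (Qcirc N (suc m) (Qsq N m f)) e ≈
        (D (suc m) (e⁺ (suc m)) + sumFrom (suc (suc m)) (N ∸ suc m) (λ j → D j (e⁺ j))) + - defectA m
      coeff-Qcirc∘Qsq {m} m<N symm = begin
        coeff (Qcirc N (suc m) (Qsq N m f)) e
          ≈⟨ coeff-Qcirc m<N (Qsq N m f) e ⟩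
        coeff (Qsq N m f) e + sumFrom (suc (suc m)) n (λ j → coeff (Qsq N m f) (swapExp j (suc m) e))
          ≈⟨ +-cong at-e (sumFrom-cong (suc (suc m)) n at-swapped-e) ⟩
        (D (suc m) (e⁺ (suc m)) + - X) + sumFrom (suc (suc m)) n (λ j → D j (e⁺ j) + - sumFrom 1 m (Y j))
          ≈⟨ +-congˡ (trans (sumFrom-+ _ n _ _) (+-congˡ (sumFrom-neg _ n _))) ⟩
        (D (suc m) (e⁺ (suc m)) + - X)
          + (sumFrom (suc (suc m)) n (λ j → D j (e⁺ j)) + - sumFrom (suc (suc m)) n (λ j → sumFrom 1 m (Y j)))
          ≈⟨ -‿interchange _ _ _ _ ⟩
        (D (suc m) (e⁺ (suc m)) + sumFrom (suc (suc m)) n (λ j → D j (e⁺ j))) + - defectA m ∎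
        where
        n : ℕ
        n = N ∸ suc m
        X : Carrier
        X = sumFrom 1 m (λ i → D i (swapExp i (suc m) (e⁺ i)))
        Y : ℕ → ℕ → Carrier
        Y j i = D i (swapExp i (suc m) (swapExp j (suc m) (e⁺ i)))
        r[m+1] : InRange N (suc m)
        r[m+1] = s≤s z≤n , m<N
        rᵢ : ∀ {i} → 1 ≤ i → i < 1 ℕ.+ m → InRange N i
        rᵢ 1≤i i≤m = 1≤i , ≤-trans (≤-pred i≤m) (<⇒≤ m<N)
        at-e : coeff (Qsq N m f) e ≈ D (suc m) (e⁺ (suc m)) + - X
        at-e = trans (coeff-Qsq m<N f e) (+-cong (coeff-∂ r[m+1] f e) (-‿cong (sumFrom-cong 1 m λ 1≤i i≤m →
                 coeff-∂-swapExp (rᵢ 1≤i i≤m) r[m+1] r[m+1] (swapIdx-right _ (suc m)) f e)))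
        at-swapped-e : ∀ {j} → suc (suc m) ≤ j → j < suc (suc m) ℕ.+ n →
                       coeff (Qsq N m f) (swapExp j (suc m) e) ≈ D j (e⁺ j) + - sumFrom 1 m (Y j)
        at-swapped-e {j} m+1<j j<bound = trans (coeff-Qsq m<N f (swapExp j (suc m) e)) (+-cong
          (trans (coeff-∂-swapExp rⱼ r[m+1] r[m+1] (swapIdx-right j (suc m)) f e)
                 (natMul-cong (suc (getN e j)) (symm (<⇒≤ m+1<j) j≤N ≤-refl m<N (e⁺ j))))
          (-‿cong (sumFrom-cong 1 m λ {i} 1≤i i≤m →
             coeff-∂-at-swap² (rᵢ 1≤i i≤m) r[m+1] rⱼ r[m+1] r[m+1] (swapIdx-right i (suc m))
               (swapIdx-other (λ i≡j → <⇒≢ (≤-trans i≤m (<⇒≤ m+1<j)) i≡j) (<⇒≢ i≤m)))))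
          where
          j≤N : j ≤ N
          j≤N = ≤-from-sumFrom-bound m<N j<bound
          rⱼ : InRange N j
          rⱼ = ≤-trans (s≤s z≤n) m+1<j , j≤N

      defectB : ℕ → Carrier
      defectB k = sumFrom (suc (suc k)) (N ∸ suc k) (λ j → D (suc k) (swapExp j (suc k) (e⁺ (suc k))))
                + - sumFrom 1 k (λ i → sumFrom (suc (suc k)) (N ∸ suc k) (λ j →
                      D i (swapExp j (suc k) (swapExp i (suc k) (e⁺ i)))))

      coeff-Qsq∘Qcirc : ∀ {k} → suc k ≤ N → AntisymmetricCoeffs f (suc k) →
        coeff (Qsq N k (Qcirc N (suc k) f)) e ≈ sumFrom 1 (suc k) (λ i → D i (e⁺ i)) + defectB k
      coeff-Qsq∘Qcirc {k} k<N anti = begin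
        coeff (Qsq N k h) e
          ≈⟨ coeff-Qsq k<N h e ⟩
        coeff (∂ M h) e + - sumFrom 1 k (λ i → coeff (∂ M h) (swapExp i M e))
          ≈⟨ +-cong (trans (coeff-∂ rM h e) (natMul-coeff-Qcirc M (e⁺ M))) (-‿cong (sumFrom-cong 1 k at-swapped-e)) ⟩
        (D M (e⁺ M) + Y) + - sumFrom 1 k (λ i → - D i (e⁺ i) + W i)
          ≈⟨ +-congˡ (-‿cong (trans (sumFrom-+ 1 k _ W) (+-congʳ (sumFrom-neg 1 k _)))) ⟩
        (D M (e⁺ M) + Y) + - (- S + sumFrom 1 k W)
          ≈⟨ +-congˡ (trans (-‿+ _ _) (+-congʳ (⁻¹-involutive S))) ⟩
        (D M (e⁺ M) + Y) + (S + - sumFrom 1 k W)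
          ≈⟨ interchange _ _ _ _ ⟩
        (D M (e⁺ M) + S) + (Y + - sumFrom 1 k W)
          ≈⟨ +-congʳ (trans (+-comm _ _) (sym (sumFrom-snoc 1 k (λ i → D i (e⁺ i))))) ⟩
        sumFrom 1 M (λ i → D i (e⁺ i)) + defectB k ∎
        where
        M n : ℕ
        M = suc k
        n = N ∸ M
        h : Poly N
        h = Qcirc N M f
        rM : InRange N M
        rM = s≤s z≤n , k<N
        S Y : Carrier
        S = sumFrom 1 k (λ i → D i (e⁺ i))
        Y = sumFrom (suc M) n (λ j → D M (swapExp j M (e⁺ M)))
        W : ℕ → Carrier
        W i = sumFrom (suc M) n (λ j → D i (swapExp j M (swapExp i M (e⁺ i))))
        natMul-coeff-Qcirc : ∀ i x →
          natMul (suc (getN e i)) (coeff h x) ≈ D i x + sumFrom (suc M) n (λ j → D i (swapExp j M x))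
        natMul-coeff-Qcirc i x = trans (natMul-cong (suc (getN e i)) (coeff-Qcirc k<N f x))
          (trans (natMul-+ (suc (getN e i)) _ _) (+-congˡ (sumFrom-natMul (suc (getN e i)) (suc M) n _)))
        at-swapped-e : ∀ {i} → 1 ≤ i → i < 1 ℕ.+ k → coeff (∂ M h) (swapExp i M e) ≈ - D i (e⁺ i) + W i
        at-swapped-e {i} 1≤i i≤k = begin
          coeff (∂ M h) (swapExp i M e)                    ≈⟨ coeff-∂-swapExp rᵢ rM rM (swapIdx-right i M) h e ⟩
          natMul (suc (getN e i)) (coeff h (swapExp i M (e⁺ i))) ≈⟨ natMul-coeff-Qcirc i (swapExp i M (e⁺ i)) ⟩
          D i (swapExp i M (e⁺ i)) + W i
            ≈⟨ +-congʳ (trans (natMul-cong (suc (getN e i)) (anti (1≤i , <⇒≤ i≤k) (s≤s z≤n , ≤-refl) (<⇒≢ i≤k) (e⁺ i)))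
                              (natMul-neg (suc (getN e i)) _)) ⟩
          - D i (e⁺ i) + W i                               ∎
          where
          rᵢ : InRange N i
          rᵢ = 1≤i , ≤-trans (<⇒≤ i≤k) k<N

      module _ {k} (M<N : suc (suc k) ≤ N)
               (anti : AntisymmetricCoeffs f (suc k)) (symm : SymmetricCoeffs f (suc k)) where
        private
          M M⁺ n : ℕ
          M = suc k
          M⁺ = suc M
          n = N ∸ M⁺

          rM : InRange N M
          rM = s≤s z≤n , <⇒≤ M<N
          rM⁺ : InRange N M⁺
          rM⁺ = s≤s z≤n , M<N
          r≤k : ∀ {i} → 1 ≤ i → i ≤ k → InRange N i
          r≤k 1≤i i≤k = 1≤i , ≤-trans i≤k (≤-trans (ℕₚ.n≤1+n k) (<⇒≤ M<N))
          r>M⁺ : ∀ {j} → M⁺ < j → j ≤ N → InRange N j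
          r>M⁺ M⁺<j j≤N = ≤-trans (s≤s z≤n) M⁺<j , j≤N

          M⁺≢M : M⁺ ≢ M
          M⁺≢M = ℕₚ.1+n≢n
          ≤k⇒≢M : ∀ {i} → i ≤ k → i ≢ M
          ≤k⇒≢M i≤k = <⇒≢ (s≤s i≤k)
          ≤k⇒≢M⁺ : ∀ {i} → i ≤ k → i ≢ M⁺
          ≤k⇒≢M⁺ i≤k = <⇒≢ (s≤s (ℕₚ.m≤n⇒m≤1+n i≤k))
          >M⁺⇒≢M : ∀ {j} → M⁺ < j → j ≢ M
          >M⁺⇒≢M M⁺<j = ≢-sym (<⇒≢ (<⇒≤ M⁺<j))
          >M⁺⇒≢M⁺ : ∀ {j} → M⁺ < j → j ≢ M⁺
          >M⁺⇒≢M⁺ M⁺<j = ≢-sym (<⇒≢ M⁺<j)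
          ≤k⇒≢>M⁺ : ∀ {i j} → i ≤ k → M⁺ < j → i ≢ j
          ≤k⇒≢>M⁺ i≤k M⁺<j = <⇒≢ (≤-trans (s≤s i≤k) (≤-trans (ℕₚ.n≤1+n M) (<⇒≤ M⁺<j)))

        coeff-swap-i[M⁺] : ∀ {i} → 1 ≤ i → i ≤ k → ∀ x →
                           coeff f (swapExp i M⁺ x) ≈ - coeff f (swapExp M⁺ M (swapExp i M x))
        coeff-swap-i[M⁺] {i} 1≤i i≤k x = begin
          coeff f (swapExp i M⁺ x)
            ≡⟨ cong (coeff f) (≡.sym (swapExp-conj (r≤k 1≤i i≤k) rM⁺ rM (≤k⇒≢M⁺ i≤k) (≤k⇒≢M i≤k) M⁺≢M x)) ⟩
          coeff f (swapExp i M (swapExp M⁺ M (swapExp i M x)))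
            ≈⟨ anti (1≤i , ℕₚ.m≤n⇒m≤1+n i≤k) (s≤s z≤n , ≤-refl) (≤k⇒≢M i≤k) _ ⟩
          - coeff f (swapExp M⁺ M (swapExp i M x)) ∎

        coeff-swap-M[M⁺]∘j[M⁺] : ∀ {j} → M⁺ < j → j ≤ N → ∀ x →
                                 coeff f (swapExp M M⁺ (swapExp j M⁺ x)) ≈ coeff f (swapExp j M x)
        coeff-swap-M[M⁺]∘j[M⁺] {j} M⁺<j j≤N x = begin
          coeff f (swapExp M M⁺ (swapExp j M⁺ x))
            ≡⟨ cong (coeff f) (≡.sym (swapExp-involutive rⱼ rM⁺ _)) ⟩
          coeff f (swapExp j M⁺ (swapExp j M⁺ (swapExp M M⁺ (swapExp j M⁺ x))))
            ≡⟨ cong (coeff f ∘ swapExp j M⁺) (swapExp-conj rⱼ rM rM⁺ (>M⁺⇒≢M M⁺<j) (>M⁺⇒≢M⁺ M⁺<j) (≢-sym M⁺≢M) x) ⟩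
          coeff f (swapExp j M⁺ (swapExp j M x))
            ≈⟨ symm (<⇒≤ M⁺<j) j≤N ≤-refl M<N _ ⟩
          coeff f (swapExp j M x) ∎
          where
          rⱼ : InRange N j
          rⱼ = r>M⁺ M⁺<j j≤N

        coeff-swap-i[M⁺]∘j[M⁺] : ∀ {i j} → 1 ≤ i → i ≤ k → M⁺ < j → j ≤ N → ∀ x →
                                 coeff f (swapExp i M⁺ (swapExp j M⁺ x)) ≈ - coeff f (swapExp j M (swapExp i M x))
        coeff-swap-i[M⁺]∘j[M⁺] {i} {j} 1≤i i≤k M⁺<j j≤N x = begin
          coeff f (swapExp i M⁺ (swapExp j M⁺ x))
            ≡⟨ cong (coeff f) (≡.trans (swapExp-comm i M⁺ (swapExp j M⁺ x))
                                       (cong (swapExp M⁺ i) (swapExp-comm j M⁺ x))) ⟩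
          coeff f (swapExp M⁺ i (swapExp M⁺ j x))
            ≡⟨ cong (coeff f) (≡.sym (swapExp-braid rM⁺ rᵢ rⱼ (≢-sym (≤k⇒≢M⁺ i≤k)) (≢-sym (>M⁺⇒≢M⁺ M⁺<j))
                                                      (≤k⇒≢>M⁺ i≤k M⁺<j) x)) ⟩
          coeff f (swapExp M⁺ j (swapExp i j x))
            ≡⟨ cong (coeff f ∘ swapExp M⁺ j)
                    (≡.sym (swapExp-conj rᵢ rⱼ rM (≤k⇒≢>M⁺ i≤k M⁺<j) (≤k⇒≢M i≤k) (>M⁺⇒≢M M⁺<j) x)) ⟩
          coeff f (swapExp M⁺ j (swapExp i M (swapExp j M (swapExp i M x))))
            ≈⟨ symm ≤-refl M<N (<⇒≤ M⁺<j) j≤N _ ⟩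
          coeff f (swapExp i M (swapExp j M (swapExp i M x)))
            ≈⟨ anti (1≤i , ℕₚ.m≤n⇒m≤1+n i≤k) (s≤s z≤n , ≤-refl) (≤k⇒≢M i≤k) _ ⟩
          - coeff f (swapExp j M (swapExp i M x)) ∎
          where
          rᵢ : InRange N i
          rᵢ = r≤k 1≤i i≤k
          rⱼ : InRange N j
          rⱼ = r>M⁺ M⁺<j j≤N

        private
          Z : ℕ → Carrier
          Z i = D i (swapExp M⁺ M (swapExp i M (e⁺ i)))
          W : ℕ → ℕ → Carrier
          W i j = D i (swapExp j M (swapExp i M (e⁺ i)))
          X : Carrier
          X = D M (swapExp M⁺ M (e⁺ M))
          Y : ℕ → Carrier
          Y j = D M (swapExp j M (e⁺ M))
          ΣZ ΣY ΣΣW : Carrier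
          ΣZ = sumFrom 1 k Z
          ΣY = sumFrom (suc M⁺) n Y
          ΣΣW = sumFrom 1 k (λ i → sumFrom (suc M⁺) n (W i))

        defectA-split : defectA M ≈ (- ΣZ + X) + (- ΣΣW + ΣY)
        defectA-split = +-cong single double
          where
          D-neg : ∀ i {x y} → coeff f x ≈ - coeff f y → D i x ≈ - D i y
          D-neg i x≈-y = trans (natMul-cong (suc (getN e i)) x≈-y) (natMul-neg (suc (getN e i)) _)
          single : sumFrom 1 M (λ i → D i (swapExp i M⁺ (e⁺ i))) ≈ - ΣZ + X
          single = begin
            sumFrom 1 M (λ i → D i (swapExp i M⁺ (e⁺ i)))
              ≈⟨ sumFrom-snoc 1 k _ ⟩
            sumFrom 1 k (λ i → D i (swapExp i M⁺ (e⁺ i))) + D M (swapExp M M⁺ (e⁺ M))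
              ≈⟨ +-cong (sumFrom-cong 1 k λ {i} 1≤i i<1+k → D-neg i (coeff-swap-i[M⁺] 1≤i (≤-pred i<1+k) (e⁺ i)))
                        (reflexive (cong (D M) (swapExp-comm M M⁺ (e⁺ M)))) ⟩
            sumFrom 1 k (λ i → - Z i) + X
              ≈⟨ +-congʳ (sumFrom-neg 1 k Z) ⟩
            - ΣZ + X ∎
          double : sumFrom (suc M⁺) n (λ j → sumFrom 1 M (λ i → D i (swapExp i M⁺ (swapExp j M⁺ (e⁺ i))))) ≈ - ΣΣW + ΣY
          double = begin
            sumFrom (suc M⁺) n (λ j → sumFrom 1 M (λ i → D i (swapExp i M⁺ (swapExp j M⁺ (e⁺ i)))))
              ≈⟨ sumFrom-cong (suc M⁺) n (λ M⁺<j j<bound → let j≤N = ≤-from-sumFrom-bound M<N j<bound in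
                   trans (sumFrom-snoc 1 k _) (+-cong
                     (sumFrom-cong 1 k λ {i} 1≤i i<1+k →
                       D-neg i (coeff-swap-i[M⁺]∘j[M⁺] 1≤i (≤-pred i<1+k) M⁺<j j≤N (e⁺ i)))
                     (natMul-cong (suc (getN e M)) (coeff-swap-M[M⁺]∘j[M⁺] M⁺<j j≤N (e⁺ M))))) ⟩
            sumFrom (suc M⁺) n (λ j → sumFrom 1 k (λ i → - W i j) + Y j)
              ≈⟨ trans (sumFrom-+ (suc M⁺) n _ Y)
                       (+-congʳ (sumFrom-cong′ (suc M⁺) n λ j → sumFrom-neg 1 k (λ i → W i j))) ⟩
            sumFrom (suc M⁺) n (λ j → - sumFrom 1 k (λ i → W i j)) + ΣY
              ≈⟨ +-congʳ (trans (sumFrom-neg (suc M⁺) n _)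
                                (-‿cong (sumFrom-comm (suc M⁺) n 1 k (λ j i → W i j)))) ⟩
            - ΣΣW + ΣY ∎

        defectB-split : defectB k ≈ (X + ΣY) + - (ΣZ + ΣΣW)
        defectB-split = begin
          defectB k
            ≡⟨ cong (λ m → sumFrom M⁺ m Y + - sumFrom 1 k (λ i → sumFrom M⁺ m (W i))) (+-∸-assoc 1 M<N) ⟩
          (X + ΣY) + - sumFrom 1 k (λ i → Z i + sumFrom (suc M⁺) n (W i))
            ≈⟨ +-congˡ (-‿cong (sumFrom-+ 1 k Z _)) ⟩
          (X + ΣY) + - (ΣZ + ΣΣW) ∎

        defectA≈defectB : defectA M ≈ defectB k
        defectA≈defectB = begin
          defectA M                      ≈⟨ defectA-split ⟩
          (- ΣZ + X) + (- ΣΣW + ΣY)      ≈⟨ +-cong (+-comm _ _) (+-comm _ _) ⟩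
          (X + - ΣZ) + (ΣY + - ΣΣW)      ≈⟨ -‿interchange X ΣY ΣZ ΣΣW ⟩
          (X + ΣY) + - (ΣZ + ΣΣW)        ≈⟨ sym defectB-split ⟩
          defectB k                      ∎

      anticommutator-middle : ∀ {k} → suc (suc k) ≤ N → AntisymmetricCoeffs f (suc k) → SymmetricCoeffs f (suc k) →
        coeff (Qcirc N (suc (suc k)) (Qsq N (suc k) f) +P Qsq N k (Qcirc N (suc k) f)) e ≈ coeff (Lplus N f) e
      anticommutator-middle {k} M<N anti symm = begin
        coeff (Qcirc N (suc M) (Qsq N M f) +P Qsq N k (Qcirc N M f)) e
          ≈⟨ coeff-+P (Qcirc N (suc M) (Qsq N M f)) _ e ⟩
        coeff (Qcirc N (suc M) (Qsq N M f)) e + coeff (Qsq N k (Qcirc N M f)) e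
          ≈⟨ +-cong (coeff-Qcirc∘Qsq M<N symm) (coeff-Qsq∘Qcirc (<⇒≤ M<N) anti) ⟩
        (J + - defectA M) + (I + defectB k)  ≈⟨ +-congʳ (+-congˡ (-‿cong (defectA≈defectB M<N anti symm))) ⟩
        (J + - defectB k) + (I + defectB k)  ≈⟨ trans (-‿cancel J I (defectB k)) (+-comm J I) ⟩
        I + J                                ≈⟨ sym (sumFrom-1-split (λ i → D i (e⁺ i)) M<N) ⟩
        sumFrom 1 N (λ i → D i (e⁺ i))       ≈⟨ sym (coeff-Lplus f e) ⟩
        coeff (Lplus N f) e                  ∎
        where
        M : ℕ
        M = suc k
        I J : Carrier
        I = sumFrom 1 M (λ i → D i (e⁺ i))
        J = D (suc M) (e⁺ (suc M)) + sumFrom (suc (suc M)) (N ∸ suc M) (λ j → D j (e⁺ j))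

      anticommutator-bottom : 0 < N → SymmetricCoeffs f 0 →
        coeff (Qcirc N 1 (Qsq N 0 f) +P Qsq N 0 (Qcirc N 0 f)) e ≈ coeff (Lplus N f) e
      anticommutator-bottom 0<N symm = begin
        coeff (Qcirc N 1 (Qsq N 0 f) +P Qsq N 0 zeroP) e
          ≈⟨ coeff-+P (Qcirc N 1 (Qsq N 0 f)) _ e ⟩
        coeff (Qcirc N 1 (Qsq N 0 f)) e + coeff (Qsq N 0 zeroP) e
          ≈⟨ +-cong (coeff-Qcirc∘Qsq 0<N symm) (reflexive (cong (λ q → coeff q e) (Qsq-unfold (<⇒≢ 0<N) zeroP))) ⟩
        (J + - defectA 0) + 0#              ≈⟨ +-identityʳ _ ⟩
        J + - defectA 0                     ≈⟨ +-congˡ (-‿cong (trans (+-identityˡ _) (sumFrom-0# 2 (N ∸ 1)))) ⟩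
        J + - 0#                            ≈⟨ trans (+-congˡ ε⁻¹≈ε) (+-identityʳ J) ⟩
        J                                   ≈⟨ sym (trans (sumFrom-1-split (λ i → D i (e⁺ i)) 0<N) (+-identityˡ J)) ⟩
        sumFrom 1 N (λ i → D i (e⁺ i))      ≈⟨ sym (coeff-Lplus f e) ⟩
        coeff (Lplus N f) e                 ∎
        where
        J : Carrier
        J = D 1 (e⁺ 1) + sumFrom 2 (N ∸ 1) (λ j → D j (e⁺ j))

      anticommutator-top : ∀ {k} → suc k ≡ N → AntisymmetricCoeffs f (suc k) →
        coeff (Qcirc N (suc (suc k)) (Qsq N (suc k) f) +P Qsq N k (Qcirc N (suc k) f)) e ≈ coeff (Lplus N f) e
      anticommutator-top {k} M≡N anti = begin
        coeff (Qcirc N (suc M) (Qsq N M f) +P Qsq N k (Qcirc N M f)) e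
          ≈⟨ coeff-+P (Qcirc N (suc M) (Qsq N M f)) _ e ⟩
        coeff (Qcirc N (suc M) (Qsq N M f)) e + coeff (Qsq N k (Qcirc N M f)) e
          ≈⟨ +-cong (reflexive (cong (λ q → coeff (Qcirc N (suc M) q) e) (Qsq-top M≡N f)))
                    (coeff-Qsq∘Qcirc (ℕₚ.≤-reflexive M≡N) anti) ⟩
        coeff (Qcirc N (suc M) zeroP) e + (I + defectB k)
          ≈⟨ +-cong (trans (coeff-sumP-range (suc (suc M)) N _ e) (sumFrom-0# (suc (suc M)) (N ∸ suc M)))
                    (+-congˡ defectB-vanishes) ⟩
        0# + (I + 0#)                       ≈⟨ trans (+-identityˡ _) (+-identityʳ I) ⟩
        I                                   ≡⟨ cong (λ n → sumFrom 1 n (λ i → D i (e⁺ i))) M≡N ⟩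
        sumFrom 1 N (λ i → D i (e⁺ i))      ≈⟨ sym (coeff-Lplus f e) ⟩
        coeff (Lplus N f) e                 ∎
        where
        M : ℕ
        M = suc k
        I : Carrier
        I = sumFrom 1 M (λ i → D i (e⁺ i))
        defectB-vanishes : defectB k ≈ 0#
        defectB-vanishes = begin
          defectB k
            ≡⟨ cong (λ n → sumFrom (suc M) n (λ j → D M (swapExp j M (e⁺ M)))
                         + - sumFrom 1 k (λ i → sumFrom (suc M) n (λ j → D i (swapExp j M (swapExp i M (e⁺ i))))))
                    (≡.trans (cong (_∸ M) (≡.sym M≡N)) (n∸n≡0 M)) ⟩
          0# + - sumFrom 1 k (λ _ → 0#)     ≈⟨ trans (+-identityˡ _) (trans (-‿cong (sumFrom-0# 1 k)) ε⁻¹≈ε) ⟩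
          0#                                ∎

mainTheorem19 : ∀ {c ℓ : Level} (R : CommutativeRing c ℓ) → let open WithRing R in
    (N m : ℕ) → m ≤ N → (f : Poly N) → InAS N m f →
    Qcirc N (suc m) (Qsq N m f) +P Qsq N (m ∸ 1) (Qcirc N m f) ≈P Lplus N f
mainTheorem19 R zero zero _ f _ e = CommutativeRing.refl R  -- both sides reduce to []
mainTheorem19 R (suc N) zero _ f (_ , symIn) e =
  Anticommutator.anticommutator-bottom R f e (s≤s z≤n) (symIn⇒coeffs R f symIn)
mainTheorem19 R N (suc k) M≤N f (antiIn , symIn) e with m≤n⇒m<n∨m≡n M≤N
... | inj₁ M<N =
  Anticommutator.anticommutator-middle R f e M<N (antisymIn⇒coeffs R f M≤N antiIn) (symIn⇒coeffs R f symIn)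
... | inj₂ M≡N = Anticommutator.anticommutator-top R f e M≡N (antisymIn⇒coeffs R f M≤N antiIn)
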